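{- Let $(\phi,\mathbf{B})$ be a QCSP instance. An empty judgement on $(\phi,\mathbf{B})$ is derivable if and only if $\mathbf{B}\not\models\phi$.
   Context: Multi-sorted relational first-order logic: a signature is a pair $(\sigma,\mathcal{S})$ of a set $\mathcal{S}$ of sorts and a set $\sigma$ of relation symbols, each $R\in\sigma$ having an arity $\mathrm{ar}(R)\in\mathcal{S}^*$. Each variable $v$ has a sort $s(v)$; an atom is $R(v_1,\dots,v_k)$ with $s(v_1)\cdots s(v_k)=\mathrm{ar}(R)$. A structure $\mathbf{B}$ consists of sets $B_s$ ($s\in\mathcal{S}$) and relations $R^{\mathbf{B}}\subseteq B_{w_1}\times\cdots\times B_{w_k}$ where $\mathrm{ar}(R)=w_1\cdots w_k$. A "map $f:V\to B$" on a set $V$ of variables satisfies $f(v)\in B_{s(v)}$. $f\upharpoonright S$ is restriction; $f[s\to b]$ is the extension mapping $s$ to $b$. A qc-formula is built from atoms, conjunction (arbitrary finite arity), $\forall$ and $\exists$; $\mathrm{free}(\phi)$ denotes its free variables; a qc-sentence has none. A QCSP instance is a pair $(\phi,\mathbf{B})$ of a qc-sentence and a structure over the same signature. Viewing $\phi$ as a tree, $I_\phi$ contains one index (location) per subformula occurrence; $\phi(i)$ is the subformula at $i$; parent/child refer to the tree. A constraint is $(V,F)$ with $V$ a set of variables occurring in $\phi$ and $F$ a set of maps $V\to B$ (exactly one map $\emptyset\to B$ exists). A judgement is $(i,V,F)$ with $i\in I_\phi$, $(V,F)$ a constraint, $V\subseteq\mathrm{free}(\phi(i))$; it is empty if $F=\emptyset$.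 $F_1\Join F_2=\{f:U_1\cup U_2\to B: f\upharpoonright U_1\in F_1, f\upharpoonright U_2\in F_2\}$ for constraints $(U_1,F_1),(U_2,F_2)$; for $y\in U$, $\epsilon_yF=\{f:U\setminus\{y\}\to B: f[y\to b]\in F \text{ for all } b\in B_{s(y)}\}$. A judgement proof is a finite sequence of judgements each of one of the types: (atom) $(i,\{v_1,\dots,v_k\},F)$ where $\phi(i)=R(v_1,\dots,v_k)$ and $F=\{f:(f(v_1),\dots,f(v_k))\in R^{\mathbf{B}}\}$; (projection) $(i,U,F\upharpoonright U)$ from a previous $(i,V,F)$ with $U\subseteq V$; (join) $(i,U_1\cup U_2,F_1\Join F_2)$ from previous $(i,U_1,F_1),(i,U_2,F_2)$; (upward flow) $(i,V,F)$ from previous $(j,V,F)$ with $i$ the parent of $j$; ($\forall$-elimination) $(i,V\setminus\{y\},\epsilon_yF)$ from previous $(j,V,F)$ with $y\in V$, $\phi(i)=\forall y\,\phi(j)$, $i$ the parent of $j$; (downward flow) $(j,V,F)$ from previous $(i,V,F)$ with $i$ the parent of $j$. A judgement is derivable if it occurs in some judgement proof. -}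

module Defs where

open import Data.Bool using (Bool; true; false; T; _∧_; _∨_; not)
open import Data.List using (List; []; _∷_; map)
open import Data.List.Relation.Unary.All using (All; []; _∷_)
open import Data.List.Relation.Unary.Any using (Any; here; there; any?)
open import Data.List.Membership.Propositional using (_∈_)
open import Data.Product using (Σ; _×_; _,_)
open import Data.Unit using (tt)
open import Data.Empty using (⊥-elim)
open import Relation.Nullary using (¬_; does; yes; no)
open import Relation.Nullary.Decidable using (fromWitness; isYes)
open import Relation.Binary.Definitions using (DecidableEquality)
open import Relation.Binary.PropositionalEquality using (_≡_; refl; subst)

-- Variables need
-- decidable equality so that extensions f[y → b] can be formed.

record Signature : Set₁ where
  field
    Sort  : Set
    Rel   : Set
    arity : Rel → List Sort
    Var   : Set
    sort  : Var → Sort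
    _≟_   : DecidableEquality Var

module QCSP (sig : Signature) where
  open Signature sig

  -- Sets of variables, represented by their (decidable) characteristic
  -- function.  Membership proofs are then proof-irrelevant.

  VarSet : Set
  VarSet = Var → Bool

  _∈ᵥ_ : Var → VarSet → Set
  v ∈ᵥ V = T (V v)

  _⊆_ : VarSet → VarSet → Set
  U ⊆ V = ∀ v → v ∈ᵥ U → v ∈ᵥ V

  ∅ᵥ : VarSet
  ∅ᵥ _ = false

  _∪_ : VarSet → VarSet → VarSet
  (U ∪ W) v = U v ∨ W v

  _∖[_] : VarSet → Var → VarSet
  (V ∖[ y ]) v = not (does (v ≟ y)) ∧ V v

  setOf : List Var → VarSet
  setOf vs v = isYes (any? (v ≟_) vs)

  data Form : Set where
    atom : (R : Rel) (vs : List Var) → map sort vs ≡ arity R → Form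
    conj : List Form → Form
    all  : Var → Form → Form
    ex   : Var → Form → Form

  mutual
    free : Form → VarSet
    free (atom R vs _) = setOf vs
    free (conj ψs)     = freeList ψs
    free (all y ψ)     = free ψ ∖[ y ]
    free (ex y ψ)      = free ψ ∖[ y ]

    freeList : List Form → VarSet
    freeList []       v = false
    freeList (ψ ∷ ψs) v = free ψ v ∨ freeList ψs v

  IsSentence : Form → Set
  IsSentence φ = ∀ v → free φ v ≡ false

  -- Child ψ χ: χ is an immediate
  -- subformula occurrence of ψ (occurrences in a conjunction are
  -- distinguished by the membership proof, i.e. by position).
  -- Path φ ψ: a location of φ whose subformula is ψ; the parent of
  -- (step p c) is p.

  data Child : Form → Form → Set where
    cConj : ∀ {ψs χ} → χ ∈ ψs → Child (conj ψs) χ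
    cAll  : ∀ {y χ} → Child (all y χ) χ
    cEx   : ∀ {y χ} → Child (ex y χ) χ

  data Path (φ : Form) : Form → Set where
    root : Path φ φ
    step : ∀ {ψ χ} → Path φ ψ → Child ψ χ → Path φ χ

  record Structure : Set₁ where
    field
      Dom      : Sort → Set
      nonempty : ∀ s → Dom s
      rel      : (R : Rel) → All Dom (arity R) → Set

  module _ (B : Structure) where
    open Structure B

    Env : Set
    Env = (v : Var) → Dom (sort v)

    updEnv : Env → (y : Var) → Dom (sort y) → Env
    updEnv e y b v with v ≟ y
    ... | yes refl = b
    ... | no _     = e v

    tupleEnv : (vs : List Var) → Env → All Dom (map sort vs)
    tupleEnv []       e = []
    tupleEnv (v ∷ vs) e = e v ∷ tupleEnv vs e

    mutual
      Sat : Form → Env → Set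
      Sat (atom R vs eq) e = rel R (subst (All Dom) eq (tupleEnv vs e))
      Sat (conj ψs)      e = SatAll ψs e
      Sat (all y ψ)      e = (b : Dom (sort y)) → Sat ψ (updEnv e y b)
      Sat (ex y ψ)       e = Σ (Dom (sort y)) λ b → Sat ψ (updEnv e y b)

      SatAll : List Form → Env → Set
      SatAll []       e = Data.Unit.⊤
      SatAll (ψ ∷ ψs) e = Sat ψ e × SatAll ψs e

    -- B ⊨ φ (for a sentence φ the environment is irrelevant)
    _⊨_ : Form → Set
    _⊨_ φ = (e : Env) → Sat φ e

    Map : VarSet → Set
    Map V = (v : Var) → v ∈ᵥ V → Dom (sort v)

    Constraint : VarSet → Set₁
    Constraint V = Map V → Set

    IsEmpty : ∀ {V} → Constraint V → Set
    IsEmpty F = ∀ f → ¬ F f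

    restrict : ∀ {U V} → U ⊆ V → Map V → Map U
    restrict sub f v p = f v (sub v p)

    Proj : ∀ {U V} → U ⊆ V → Constraint V → Constraint U
    Proj {U} {V} sub F g =
      Σ (Map V) λ f → F f × (∀ v (p : v ∈ᵥ U) → g v p ≡ f v (sub v p))

    ∪-inl : ∀ U W → U ⊆ (U ∪ W)
    ∪-inl U W v p with U v
    ... | true = tt

    ∪-inr : ∀ U W → W ⊆ (U ∪ W)
    ∪-inr U W v p with U v
    ... | true  = tt
    ... | false = p

    Join : ∀ {U W} → Constraint U → Constraint W → Constraint (U ∪ W)
    Join {U} {W} F₁ F₂ f =
      F₁ (restrict (∪-inl U W) f) × F₂ (restrict (∪-inr U W) f)

    ∖-intro : ∀ V {v y} → ¬ v ≡ y → v ∈ᵥ V → v ∈ᵥ (V ∖[ y ])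
    ∖-intro V {v} {y} v≢y p with v ≟ y
    ... | yes v≡y = ⊥-elim (v≢y v≡y)
    ... | no _    = p

    extend : ∀ {V} (y : Var) → Map (V ∖[ y ]) → Dom (sort y) → Map V
    extend {V} y f b v p with v ≟ y
    ... | yes refl = b
    ... | no v≢y   = f v (∖-intro V v≢y p)

    Eps : ∀ {V} (y : Var) → Constraint V → Constraint (V ∖[ y ])
    Eps y F g = (b : Dom (sort y)) → F (extend y g b)

    tupleMap : ∀ {V} (vs : List Var) → (∀ {v} → v ∈ vs → v ∈ᵥ V) →
               Map V → All Dom (map sort vs)
    tupleMap []       mem f = []
    tupleMap (v ∷ vs) mem f = f v (mem (here refl)) ∷ tupleMap vs (λ m → mem (there m)) f

    memSetOf : ∀ {vs v} → v ∈ vs → v ∈ᵥ setOf vs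
    memSetOf {vs} {v} m = fromWitness {a? = any? (v ≟_) vs} m

    AtomC : (R : Rel) (vs : List Var) → map sort vs ≡ arity R →
            Constraint (setOf vs)
    AtomC R vs eq f = rel R (subst (All Dom) eq (tupleMap vs memSetOf f))

    -- Every derivable judgement
    -- satisfies V ⊆ free(φ(i)); for the two flow rules this is an
    -- explicit side condition, for the others it is automatic.

    data Derivable (φ : Form) : ∀ {ψ} → Path φ ψ → (V : VarSet) → Constraint V → Set₁ where
      atomR : ∀ {R vs eq} (i : Path φ (atom R vs eq)) →
              Derivable φ i (setOf vs) (AtomC R vs eq)
      projR : ∀ {ψ} {i : Path φ ψ} {U V F} → Derivable φ i V F →
              (sub : U ⊆ V) → Derivable φ i U (Proj sub F)
      joinR : ∀ {ψ} {i : Path φ ψ} {U₁ U₂ F₁ F₂} →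
              Derivable φ i U₁ F₁ → Derivable φ i U₂ F₂ →
              Derivable φ i (U₁ ∪ U₂) (Join F₁ F₂)
      upR   : ∀ {ψ χ} {i : Path φ ψ} (c : Child ψ χ) {V F} →
              Derivable φ (step i c) V F → V ⊆ free ψ → Derivable φ i V F
      ∀elimR : ∀ {y χ} {i : Path φ (all y χ)} {V F} →
              Derivable φ (step i cAll) V F → y ∈ᵥ V →
              Derivable φ i (V ∖[ y ]) (Eps y F)
      downR : ∀ {ψ χ} {i : Path φ ψ} (c : Child ψ χ) {V F} →
              Derivable φ i V F → V ⊆ free χ → Derivable φ (step i c) V F

    EmptyJudgementDerivable : Form → Set₁
    EmptyJudgementDerivable φ =
      Σ Form λ ψ → Σ (Path φ ψ) λ i → Σ VarSet λ V → Σ (Constraint V) λ F →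
        Derivable φ i V F × IsEmpty F

-- Soundness: fix a model of φ and call an environment reachable at a location
-- if it arises by descending from the root, instantiating universal variables
-- arbitrarily and existential ones by witnesses.  Every derivable judgement
-- (i, V, F) contains the restriction to V of every environment reachable at i;
-- since some environment is reachable everywhere, no derivable F is empty.
--
-- Completeness: by induction on the subformula ψ at a location i, either ψ
-- holds everywhere or some derivable judgement (i, V, F) is a sufficient
-- condition for ψ (every environment agreeing with some f ∈ F satisfies ψ).
-- The rules mirror the connectives: join for ∧, ∀-elimination for ∀,
-- projection and upward flow for ∃.  At the root V is empty because φ is a
-- sentence, so a nonempty F would make φ true.
module Submission where

open import Defs
open import Data.Bool using (T)
open import Data.Bool.Properties using (T-∨; T-irrelevant)
open import Data.Empty using (⊥-elim)
open import Data.List using ([]; _∷_)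
open import Data.List.Membership.Propositional using (_∈_)
open import Data.List.Relation.Unary.All using (All; _∷_)
open import Data.List.Relation.Unary.Any using (here; there)
open import Data.Product using (Σ; _×_; _,_; proj₂)
open import Data.Sum using (_⊎_; inj₁; inj₂; map₂)
open import Data.Unit using (tt)
open import Function using (id; _∘_)
open import Function.Bundles using (_⇔_; mk⇔; Equivalence)
open import Relation.Nullary using (¬_; yes; no)
open import Relation.Nullary.Decidable using (T?)
open import Relation.Binary.PropositionalEquality
  using (_≡_; _≢_; refl; sym; trans; cong; cong₂; subst)

module _ (sig : Signature) where
  open Signature sig
  open QCSP sig

  ∖-⊆ : ∀ V {y} → (V ∖[ y ]) ⊆ V
  ∖-⊆ V {y} v p with v ≟ y
  ... | no _ = p

  ∈∖⇒≢ : ∀ V {v y} → v ∈ᵥ (V ∖[ y ]) → v ≢ y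
  ∈∖⇒≢ V {v} {y} p v≡y with v ≟ y
  ... | no v≢y = v≢y v≡y

  ⊆∖⇒∉ : ∀ {U V y} → U ⊆ (V ∖[ y ]) → ¬ y ∈ᵥ U
  ⊆∖⇒∉ {V = V} U⊆V∖y y∈U = ∈∖⇒≢ V (U⊆V∖y _ y∈U) refl

  ∖-mono : ∀ {U V} y → U ⊆ V → (U ∖[ y ]) ⊆ (V ∖[ y ])
  ∖-mono y U⊆V v p with v ≟ y
  ... | no _ = U⊆V v p

  ∪-least : ∀ {U W X} → U ⊆ X → W ⊆ X → (U ∪ W) ⊆ X
  ∪-least {U} {W} U⊆X W⊆X v p with Equivalence.to T-∨ p
  ... | inj₁ v∈U = U⊆X v v∈U
  ... | inj₂ v∈W = W⊆X v v∈W

  free-⊆-freeList : ∀ {χ ψs} → χ ∈ ψs → free χ ⊆ freeList ψs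
  free-⊆-freeList (here refl) v p = Equivalence.from T-∨ (inj₁ p)
  free-⊆-freeList (there m)   v p = Equivalence.from T-∨ (inj₂ (free-⊆-freeList m v p))

  satAll-∈ : ∀ {B χ ψs e} → χ ∈ ψs → SatAll B ψs e → Sat B χ e
  satAll-∈ (here refl) (s , _)  = s
  satAll-∈ (there m)   (_ , ss) = satAll-∈ m ss

  module _ (B : Structure) where
    open Structure B

    Agree : (V : VarSet) → Map B V → Env B → Set
    Agree V f e = ∀ v (p : v ∈ᵥ V) → f v p ≡ e v

    envMap : (V : VarSet) → Env B → Map B V
    envMap V e v _ = e v

    ⊆-∖ : ∀ {U V y} → U ⊆ V → ¬ y ∈ᵥ U → U ⊆ (V ∖[ y ])
    ⊆-∖ {V = V} U⊆V y∉U v p = ∖-intro B V (λ { refl → y∉U p }) (U⊆V v p)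

    updEnv-≢ : ∀ e {y} b {v} → v ≢ y → updEnv B e y b v ≡ e v
    updEnv-≢ e {y} b {v} v≢y with v ≟ y
    ... | yes refl = ⊥-elim (v≢y refl)
    ... | no _     = refl

    agree-updEnv⁺ : ∀ {V f e y} b → ¬ y ∈ᵥ V → Agree V f e → Agree V f (updEnv B e y b)
    agree-updEnv⁺ {e = e} b y∉V ag v p =
      trans (ag v p) (sym (updEnv-≢ e b λ { refl → y∉V p }))

    agree-updEnv⁻ : ∀ {V f e y b} → ¬ y ∈ᵥ V → Agree V f (updEnv B e y b) → Agree V f e
    agree-updEnv⁻ {e = e} {b = b} y∉V ag v p =
      trans (ag v p) (updEnv-≢ e b λ { refl → y∉V p })

    agree-extend : ∀ {V y g e} b → Agree (V ∖[ y ]) g e →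
                   Agree V (extend B y g b) (updEnv B e y b)
    agree-extend {V} {y} b ag v p with v ≟ y
    ... | yes refl = refl
    ... | no v≢y   = ag v (∖-intro B V v≢y p)

    agree-off-updEnv : ∀ {V y} (f : Map B V) e →
                       (∀ v (p : v ∈ᵥ (V ∖[ y ])) → f v (∖-⊆ V v p) ≡ e v) →
                       Σ (Dom (sort y)) λ b → Agree V f (updEnv B e y b)
    agree-off-updEnv {V} {y} f e ag with T? (V y)
    ... | yes y∈V = f y y∈V , agree
      where
      agree : Agree V f (updEnv B e y (f y y∈V))
      agree v p with v ≟ y
      ... | yes refl = cong (f y) (T-irrelevant p y∈V)
      ... | no v≢y   = trans (cong (f v) (T-irrelevant _ _)) (ag v (∖-intro B V v≢y p))
    ... | no y∉V = nonempty (sort y) , agree-updEnv⁺ _ y∉V agree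
      where
      agree : Agree V f e
      agree v p = trans (cong (f v) (T-irrelevant _ _))
                        (ag v (⊆-∖ (λ _ q → q) y∉V v p))

    tupleMap-agree : ∀ {V f e} vs (mem : ∀ {v} → v ∈ vs → v ∈ᵥ V) → Agree V f e →
                     tupleMap B vs mem f ≡ tupleEnv B vs e
    tupleMap-agree []       mem ag = refl
    tupleMap-agree (v ∷ vs) mem ag =
      cong₂ _∷_ (ag v (mem (here refl))) (tupleMap-agree vs (λ m → mem (there m)) ag)

    AtomC-agree : ∀ {R vs eq f e} → Agree (setOf vs) f e →
                  AtomC B R vs eq f ≡ Sat B (atom R vs eq) e
    AtomC-agree {R} {vs} {eq} ag =
      cong (λ t → rel R (subst (All Dom) eq t)) (tupleMap-agree vs (memSetOf B) ag)

    module _ (φ : Form) where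

      data Reachable : ∀ {ψ} → Path φ ψ → Env B → Set where
        reach-root : ∀ e → Reachable root e
        reach-conj : ∀ {ψs χ} {i : Path φ (conj ψs)} {m : χ ∈ ψs} {e} →
                     Reachable i e → Reachable (step i (cConj m)) e
        reach-all  : ∀ {y χ} {i : Path φ (all y χ)} {e} → Reachable i e →
                     (b : Dom (sort y)) → Reachable (step i cAll) (updEnv B e y b)
        reach-ex   : ∀ {y χ} {i : Path φ (ex y χ)} {e b} → Reachable i e →
                     Sat B χ (updEnv B e y b) → Reachable (step i cEx) (updEnv B e y b)

      Covers : ∀ {ψ} → Path φ ψ → (V : VarSet) → Constraint B V → Set
      Covers {ψ} i V F = V ⊆ free ψ × (∀ {e} → Reachable i e → ∀ f → Agree V f e → F f)

      module _ (⊨φ : _⊨_ B φ) where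

        reachable-sat : ∀ {ψ e} {i : Path φ ψ} → Reachable i e → Sat B ψ e
        reachable-sat (reach-root e)           = ⊨φ e
        reachable-sat (reach-conj {m = m} r)   = satAll-∈ m (reachable-sat r)
        reachable-sat (reach-all r b)          = reachable-sat r b
        reachable-sat (reach-ex r s)           = s

        reachable-exists : ∀ {ψ} (i : Path φ ψ) → Σ (Env B) (Reachable i)
        reachable-exists root = (λ v → nonempty (sort v)) , reach-root _
        reachable-exists (step i (cConj m)) with reachable-exists i
        ... | e , r = e , reach-conj r
        reachable-exists (step i (cAll {y})) with reachable-exists i
        ... | e , r = _ , reach-all r (nonempty (sort y))
        reachable-exists (step i cEx) with reachable-exists i
        ... | e , r with reachable-sat r
        ...   | b , s = _ , reach-ex r s

        covers-up : ∀ {ψ χ} {i : Path φ ψ} (c : Child ψ χ) {V F} → V ⊆ free ψ →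
                    Covers (step i c) V F → Covers i V F
        covers-up (cConj m) V⊆ψ (_ , cov) = V⊆ψ , λ r → cov (reach-conj r)
        covers-up (cAll {y}) V⊆ψ (_ , cov) = V⊆ψ , λ r f ag →
          cov (reach-all r (nonempty (sort y))) f (agree-updEnv⁺ _ (⊆∖⇒∉ V⊆ψ) ag)
        covers-up {i = i} cEx {V} {F} V⊆ψ (_ , cov) = V⊆ψ , cov-ex
          where
          cov-ex : ∀ {e} → Reachable i e → ∀ f → Agree V f e → F f
          cov-ex r f ag with reachable-sat r
          ... | b , s = cov (reach-ex r s) f (agree-updEnv⁺ b (⊆∖⇒∉ V⊆ψ) ag)

        covers-down : ∀ {ψ χ} {i : Path φ ψ} (c : Child ψ χ) {V F} → V ⊆ free χ →
                      Covers i V F → Covers (step i c) V F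
        covers-down (cConj m) V⊆χ (_ , cov) = V⊆χ , λ { (reach-conj r) → cov r }
        covers-down cAll V⊆χ (V⊆ψ , cov) =
          V⊆χ , λ { (reach-all r b) f ag → cov r f (agree-updEnv⁻ (⊆∖⇒∉ V⊆ψ) ag) }
        covers-down cEx V⊆χ (V⊆ψ , cov) =
          V⊆χ , λ { (reach-ex r s) f ag → cov r f (agree-updEnv⁻ (⊆∖⇒∉ V⊆ψ) ag) }

        derivable-covers : ∀ {ψ} {i : Path φ ψ} {V F} → Derivable B φ i V F → Covers i V F
        derivable-covers (atomR i) =
          (λ v p → p) , λ r f ag → subst id (sym (AtomC-agree ag)) (reachable-sat r)
        derivable-covers (projR d U⊆V) with derivable-covers d
        ... | V⊆ψ , cov = (λ v p → V⊆ψ v (U⊆V v p)) ,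
                          λ r g ag → envMap _ _ , cov r _ (λ _ _ → refl) , ag
        derivable-covers (joinR {U₁ = U₁} {U₂} d₁ d₂)
          with derivable-covers d₁ | derivable-covers d₂
        ... | U₁⊆ψ , cov₁ | U₂⊆ψ , cov₂ =
          ∪-least U₁⊆ψ U₂⊆ψ ,
          λ r f ag → cov₁ r _ (λ v p → ag v (∪-inl B U₁ U₂ v p)) ,
                     cov₂ r _ (λ v p → ag v (∪-inr B U₁ U₂ v p))
        derivable-covers (upR c d V⊆ψ) = covers-up c V⊆ψ (derivable-covers d)
        derivable-covers (∀elimR {y} d _) with derivable-covers d
        ... | V⊆χ , cov =
          ∖-mono y V⊆χ , λ r g ag b → cov (reach-all r b) _ (agree-extend b ag)
        derivable-covers (downR c d V⊆χ) = covers-down c V⊆χ (derivable-covers d)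

      empty-judgement⇒⊭ : EmptyJudgementDerivable B φ → ¬ _⊨_ B φ
      empty-judgement⇒⊭ (_ , i , V , F , d , F-empty) ⊨φ
        with reachable-exists ⊨φ i
      ... | e , r = F-empty (envMap V e) (proj₂ (derivable-covers ⊨φ d) r _ (λ _ _ → refl))

      record Sufficient {ψ} (i : Path φ ψ) (P : Env B → Set) : Set₁ where
        field
          dom        : VarSet
          constraint : Constraint B dom
          derivation : Derivable B φ i dom constraint
          bounded    : dom ⊆ free ψ
          sufficient : ∀ f e → Agree dom f e → constraint f → P e

      ValidOrSufficient : ∀ {ψ} → Path φ ψ → (Env B → Set) → Set₁
      ValidOrSufficient i P = (∀ e → P e) ⊎ Sufficient i P

      sufficient-conj-child : ∀ {ψs χ P} {i : Path φ (conj ψs)} (m : χ ∈ ψs) →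
                              Sufficient (step i (cConj m)) P → Sufficient i P
      sufficient-conj-child {ψs} m s = record
        { dom        = dom
        ; constraint = constraint
        ; derivation = upR (cConj m) derivation dom⊆ψs
        ; bounded    = dom⊆ψs
        ; sufficient = sufficient
        }
        where
        open Sufficient s
        dom⊆ψs : dom ⊆ freeList ψs
        dom⊆ψs v p = free-⊆-freeList m v (bounded v p)

      sufficient-join : ∀ {ψ P Q} {i : Path φ ψ} → Sufficient i P → Sufficient i Q →
                        Sufficient i (λ e → P e × Q e)
      sufficient-join s₁ s₂ = record
        { dom        = S₁.dom ∪ S₂.dom
        ; constraint = Join B S₁.constraint S₂.constraint
        ; derivation = joinR S₁.derivation S₂.derivation
        ; bounded    = ∪-least S₁.bounded S₂.bounded
        ; sufficient = λ f e ag (c₁ , c₂) →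
            S₁.sufficient _ e (λ v p → ag v (∪-inl B S₁.dom S₂.dom v p)) c₁ ,
            S₂.sufficient _ e (λ v p → ag v (∪-inr B S₁.dom S₂.dom v p)) c₂
        }
        where
        module S₁ = Sufficient s₁
        module S₂ = Sufficient s₂

      sufficient-weaken : ∀ {ψ P Q} {i : Path φ ψ} → (∀ e → P e → Q e) →
                          Sufficient i P → Sufficient i Q
      sufficient-weaken P⇒Q s = record
        { dom        = dom
        ; constraint = constraint
        ; derivation = derivation
        ; bounded    = bounded
        ; sufficient = λ f e ag c → P⇒Q e (sufficient f e ag c)
        }
        where open Sufficient s

      valid-or-sufficient-× : ∀ {ψ P Q} {i : Path φ ψ} →
                              ValidOrSufficient i P → ValidOrSufficient i Q →
                              ValidOrSufficient i (λ e → P e × Q e)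
      valid-or-sufficient-× (inj₁ ⊨P) (inj₁ ⊨Q) = inj₁ λ e → ⊨P e , ⊨Q e
      valid-or-sufficient-× (inj₁ ⊨P) (inj₂ sQ) = inj₂ (sufficient-weaken (λ e q → ⊨P e , q) sQ)
      valid-or-sufficient-× (inj₂ sP) (inj₁ ⊨Q) = inj₂ (sufficient-weaken (λ e p → p , ⊨Q e) sP)
      valid-or-sufficient-× (inj₂ sP) (inj₂ sQ) = inj₂ (sufficient-join sP sQ)

      sufficient-all : ∀ {y χ} {i : Path φ (all y χ)} →
                       Sufficient (step i cAll) (Sat B χ) → Sufficient i (Sat B (all y χ))
      sufficient-all {y} {χ} s with T? (Sufficient.dom s y)
      ... | yes y∈dom = record
        { dom        = dom ∖[ y ]
        ; constraint = Eps B y constraint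
        ; derivation = ∀elimR derivation y∈dom
        ; bounded    = ∖-mono y bounded
        ; sufficient = λ g e ag ε b →
            sufficient (extend B y g b) (updEnv B e y b) (agree-extend b ag) (ε b)
        }
        where open Sufficient s
      ... | no y∉dom = record
        { dom        = dom
        ; constraint = constraint
        ; derivation = upR cAll derivation dom⊆χ∖y
        ; bounded    = dom⊆χ∖y
        ; sufficient = λ f e ag c b → sufficient f _ (agree-updEnv⁺ b y∉dom ag) c
        }
        where
        open Sufficient s
        dom⊆χ∖y : dom ⊆ (free χ ∖[ y ])
        dom⊆χ∖y = ⊆-∖ bounded y∉dom

      sufficient-ex : ∀ {y χ} {i : Path φ (ex y χ)} →
                      Sufficient (step i cEx) (Sat B χ) → Sufficient i (Sat B (ex y χ))
      sufficient-ex {y} {χ} s = record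
        { dom        = dom ∖[ y ]
        ; constraint = Proj B (∖-⊆ dom) constraint
        ; derivation = upR cEx (projR derivation (∖-⊆ dom)) (∖-mono y bounded)
        ; bounded    = ∖-mono y bounded
        ; sufficient = witness
        }
        where
        open Sufficient s
        witness : ∀ g e → Agree (dom ∖[ y ]) g e → Proj B (∖-⊆ dom) constraint g →
                  Sat B (ex y χ) e
        witness g e ag (f , c , g≡f)
          with agree-off-updEnv f e (λ v p → trans (sym (g≡f v p)) (ag v p))
        ... | b , ag′ = b , sufficient f _ ag′ c

      mutual
        valid-or-sufficient : ∀ ψ (i : Path φ ψ) → ValidOrSufficient i (Sat B ψ)
        valid-or-sufficient (atom R vs eq) i = inj₂ record
          { dom        = setOf vs
          ; constraint = AtomC B R vs eq
          ; derivation = atomR i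
          ; bounded    = λ v p → p
          ; sufficient = λ f e ag c → subst id (AtomC-agree ag) c
          }
        valid-or-sufficient (conj ψs) i = valid-or-sufficient-all i ψs id
        valid-or-sufficient (all y χ) i with valid-or-sufficient χ (step i cAll)
        ... | inj₁ ⊨χ = inj₁ λ e b → ⊨χ _
        ... | inj₂ s  = inj₂ (sufficient-all s)
        valid-or-sufficient (ex y χ) i with valid-or-sufficient χ (step i cEx)
        ... | inj₁ ⊨χ = inj₁ λ e → nonempty (sort y) , ⊨χ _
        ... | inj₂ s  = inj₂ (sufficient-ex s)

        valid-or-sufficient-all : ∀ {ψs} (i : Path φ (conj ψs)) χs →
                                  (∀ {χ} → χ ∈ χs → χ ∈ ψs) →
                                  ValidOrSufficient i (SatAll B χs)
        valid-or-sufficient-all i []       χs⊆ψs = inj₁ λ _ → tt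
        valid-or-sufficient-all {ψs} i (χ ∷ χs) χs⊆ψs = valid-or-sufficient-×
          (map₂ (sufficient-conj-child m) (valid-or-sufficient χ (step i (cConj m))))
          (valid-or-sufficient-all i χs (χs⊆ψs ∘ there))
          where
          m : χ ∈ ψs
          m = χs⊆ψs (here refl)

      ⊭⇒empty-judgement : IsSentence φ → ¬ _⊨_ B φ → EmptyJudgementDerivable B φ
      ⊭⇒empty-judgement sentence ⊭φ with valid-or-sufficient φ root
      ... | inj₁ ⊨φ = ⊥-elim (⊭φ ⊨φ)
      ... | inj₂ s  = φ , root , dom , constraint , derivation ,
                      λ f c → ⊭φ λ e → sufficient f e (agree-on-closed f e) c
        where
        open Sufficient s
        agree-on-closed : ∀ f e → Agree dom f e
        agree-on-closed f e v p = ⊥-elim (subst T (sentence v) (bounded v p))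

theorem3p6 : (sig : Signature) → let open QCSP sig in
    (φ : Form) → IsSentence φ → (B : Structure) →
    EmptyJudgementDerivable B φ ⇔ (¬ (_⊨_ B φ))
theorem3p6 sig φ sent B = mk⇔ (empty-judgement⇒⊭ sig B φ) (⊭⇒empty-judgement sig B φ sent)
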